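{- Let $G$ be a graph of order $n$ with maximum degree $\Delta(G)$. Then $\overset{\rightarrow}{\gamma}_{LD}(G)\geq\frac{2n}{\Delta(G)+3}$.
   Context: For an orientation $D$ of a graph $G=(V,E)$ (each edge given exactly one direction), $S\subseteq V$ is locating-dominating in $D$ if every $u\notin S$ has an in-neighbour in $S$ and distinct $u,v\notin S$ have distinct sets of in-neighbours in $S$; $\gamma_{LD}(D)$ is the minimum size. $\overset{\rightarrow}{\gamma}_{LD}(G)=\min_D\gamma_{LD}(D)$ over all orientations $D$ of $G$. -}

module Defs where

open import Data.Nat using (ℕ; zero; suc; _+_; _⊔_)
open import Data.Bool using (Bool; true; false)
open import Data.Fin using (Fin; zero; suc)
open import Data.Product using (Σ; _×_; ∃-syntax)
open import Data.Sum using (_⊎_)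
open import Relation.Nullary using (¬_)
open import Relation.Binary.PropositionalEquality using (_≡_; _≢_)

record Graph (n : ℕ) : Set where
  field
    adj : Fin n → Fin n → Bool
    adj-sym : ∀ u v → adj u v ≡ adj v u
    adj-irrefl : ∀ u → adj u u ≡ false
open Graph public

countTrue : ∀ {n} → (Fin n → Bool) → ℕ
countTrue {zero} f = 0
countTrue {suc n} f with f zero
... | true = suc (countTrue (λ i → f (suc i)))
... | false = countTrue (λ i → f (suc i))

maxOver : ∀ {n} → (Fin n → ℕ) → ℕ
maxOver {zero} f = 0
maxOver {suc n} f = f zero ⊔ maxOver (λ i → f (suc i))

degree : ∀ {n} → Graph n → Fin n → ℕ
degree G v = countTrue (adj G v)

maxDegree : ∀ {n} → Graph n → ℕ
maxDegree G = maxOver (degree G)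

-- D u v ≡ true means the arc u → v is present.
-- D is an orientation of G: every edge gets exactly one direction, and arcs are only on edges.
IsOrientation : ∀ {n} → Graph n → (Fin n → Fin n → Bool) → Set
IsOrientation {n} G D =
  (∀ (u v : Fin n) → adj G u v ≡ true →
     (D u v ≡ true × D v u ≡ false) ⊎ (D u v ≡ false × D v u ≡ true))
  × (∀ (u v : Fin n) → D u v ≡ true → adj G u v ≡ true)

IsLocatingDominating : ∀ {n} → (Fin n → Fin n → Bool) → (Fin n → Bool) → Set
IsLocatingDominating {n} D S =
  (∀ (u : Fin n) → S u ≡ false → ∃[ v ] (S v ≡ true × D v u ≡ true))
  × (∀ (u w : Fin n) → S u ≡ false → S w ≡ false → u ≢ w →
       ∃[ v ] (S v ≡ true × ¬ (D v u ≡ D v w)))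

size : ∀ {n} → (Fin n → Bool) → ℕ
size S = countTrue S

{-# OPTIONS --safe #-}
module Submission where

-- Count the arcs v → u with v ∈ S and u ∉ S.  Every u ∉ S receives at least one of them, and
-- at least two unless it has a single in-neighbour v in S; charge such a u once more to that v.
-- If v were charged for two vertices u ≠ w, any vertex of S separating u from w would be a
-- second in-neighbour of u or of w.  So each v ∈ S is charged at most Δ + 1 times, giving
-- 2 (n − |S|) ≤ (Δ + 1) |S|.

open import Defs
open import Data.Nat using (ℕ; zero; suc; _+_; _*_; _≤_; z≤n; s≤s; s≤s⁻¹; _⊔_; _≡ᵇ_)
open import Data.Nat.Properties
  using ( ≤-reflexive; ≤-trans; ≤-antisym; m≤n⇒m≤1+n; +-mono-≤; +-monoʳ-≤; +-suc
        ; *-identityʳ; m≤m⊔n; m≤n⊔m; ≡ᵇ⇒≡; +-*-semiring; module ≤-Reasoning)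
open import Data.Bool using (Bool; true; false; not; _∧_; if_then_else_; T)
open import Data.Bool.Properties using (∧-identityʳ; ¬-not)
open import Data.Fin using (Fin; zero; suc)
import Data.Fin.Properties as Fin
open import Data.Product using (_×_; _,_; proj₁; proj₂; ∃-syntax)
open import Function using (_∘_)
open import Relation.Nullary using (¬_; yes; no; contradiction)
open import Relation.Binary.PropositionalEquality
open import Data.Nat.Tactic.RingSolver using (solve-∀)
open import Algebra.Properties.Semiring.Sum +-*-semiring
  using (sum; sum-syntax; sum-cong-≗; ∑-distrib-+; ∑-comm)

∑-mono-≤ : ∀ {n} {f g : Fin n → ℕ} → (∀ i → f i ≤ g i) → sum f ≤ sum g
∑-mono-≤ {zero}  f≤g = z≤n
∑-mono-≤ {suc n} f≤g = +-mono-≤ (f≤g zero) (∑-mono-≤ (f≤g ∘ suc))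

maxOver-upperBound : ∀ {n} (f : Fin n → ℕ) i → f i ≤ maxOver f
maxOver-upperBound f zero    = m≤m⊔n _ _
maxOver-upperBound f (suc i) = ≤-trans (maxOver-upperBound (f ∘ suc) i) (m≤n⊔m _ _)

countTrue-mono : ∀ {n} {f g : Fin n → Bool} → (∀ i → f i ≡ true → g i ≡ true) →
                 countTrue f ≤ countTrue g
countTrue-mono {zero} f⇒g = z≤n
countTrue-mono {suc n} {f} {g} f⇒g with f zero in f₀ | g zero in g₀
... | true  | true  = s≤s (countTrue-mono (f⇒g ∘ suc))
... | false | true  = m≤n⇒m≤1+n (countTrue-mono (f⇒g ∘ suc))
... | false | false = countTrue-mono (f⇒g ∘ suc)
... | true  | false with () ← trans (sym (f⇒g zero f₀)) g₀

countTrue-cong : ∀ {n} {f g : Fin n → Bool} → (∀ i → f i ≡ g i) → countTrue f ≡ countTrue g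
countTrue-cong f≡g = ≤-antisym (countTrue-mono (λ i → trans (sym (f≡g i))))
                               (countTrue-mono (λ i → trans (f≡g i)))

countTrue-allFalse : ∀ {n} {f : Fin n → Bool} → (∀ i → f i ≡ false) → countTrue f ≡ 0
countTrue-allFalse {zero} f≡false = refl
countTrue-allFalse {suc n} f≡false rewrite f≡false zero = countTrue-allFalse (f≡false ∘ suc)

countTrue-pos : ∀ {n} {f : Fin n → Bool} i → f i ≡ true → 1 ≤ countTrue f
countTrue-pos zero fi rewrite fi = s≤s z≤n
countTrue-pos {f = f} (suc i) fi with f zero
... | true  = s≤s z≤n
... | false = countTrue-pos i fi

countTrue≤1 : ∀ {n} {f : Fin n → Bool} → (∀ i j → f i ≡ true → f j ≡ true → i ≡ j) →
              countTrue f ≤ 1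
countTrue≤1 {zero} unique = z≤n
countTrue≤1 {suc n} {f} unique with f zero in f₀
... | true  = s≤s (≤-reflexive (countTrue-allFalse othersFalse))
  where
  othersFalse : ∀ i → f (suc i) ≡ false
  othersFalse i = ¬-not (λ fi → contradiction (unique zero (suc i) f₀ fi) λ ())
... | false = countTrue≤1 λ i j fi fj → Fin.suc-injective (unique (suc i) (suc j) fi fj)

countTrue≤1⇒unique : ∀ {n} {f : Fin n → Bool} → countTrue f ≤ 1 →
                     ∀ i j → f i ≡ true → f j ≡ true → i ≡ j
countTrue≤1⇒unique ≤1 zero zero fi fj = refl
countTrue≤1⇒unique {f = f} ≤1 zero (suc j) fi fj with f zero
... | true = contradiction (≤-trans (countTrue-pos j fj) (s≤s⁻¹ ≤1)) λ ()
countTrue≤1⇒unique {f = f} ≤1 (suc i) zero fi fj with f zero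
... | true = contradiction (≤-trans (countTrue-pos i fi) (s≤s⁻¹ ≤1)) λ ()
countTrue≤1⇒unique {f = f} ≤1 (suc i) (suc j) fi fj with f zero
... | true  = contradiction (≤-trans (countTrue-pos i fi) (s≤s⁻¹ ≤1)) λ ()
... | false = cong suc (countTrue≤1⇒unique ≤1 i j fi fj)

countTrue-complement : ∀ {n} (f : Fin n → Bool) → countTrue f + countTrue (not ∘ f) ≡ n
countTrue-complement {zero} f = refl
countTrue-complement {suc n} f with f zero
... | true  = cong suc (countTrue-complement (f ∘ suc))
... | false = trans (+-suc _ _) (cong suc (countTrue-complement (f ∘ suc)))

∑-if : ∀ {n} (f : Fin n → Bool) c → ∑[ i < n ] (if f i then c else 0) ≡ countTrue f * c
∑-if {zero} f c = refl
∑-if {suc n} f c with f zero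
... | true  = cong (c +_) (∑-if (f ∘ suc) c)
... | false = ∑-if (f ∘ suc) c

countTrue≡∑ : ∀ {n} (f : Fin n → Bool) → countTrue f ≡ ∑[ i < n ] (if f i then 1 else 0)
countTrue≡∑ f = sym (trans (∑-if f 1) (*-identityʳ _))

∑-countTrue-comm : ∀ {m n} (R : Fin m → Fin n → Bool) →
                   ∑[ j < n ] countTrue (λ i → R i j) ≡ ∑[ i < m ] countTrue (R i)
∑-countTrue-comm {m} {n} R = begin
  ∑[ j < n ] countTrue (λ i → R i j)                  ≡⟨ sum-cong-≗ (λ j → countTrue≡∑ (λ i → R i j)) ⟩
  ∑[ j < n ] ∑[ i < m ] (if R i j then 1 else 0)     ≡⟨ ∑-comm (λ j i → if R i j then 1 else 0) ⟩
  ∑[ i < m ] ∑[ j < n ] (if R i j then 1 else 0)     ≡⟨ sum-cong-≗ (λ i → countTrue≡∑ (R i)) ⟨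
  ∑[ i < m ] countTrue (R i)                          ∎
  where open ≡-Reasoning

≤-if : ∀ b {x c} → (b ≡ true → x ≤ c) → (b ≡ false → x ≡ 0) → x ≤ (if b then c else 0)
≤-if true  x≤c _   = x≤c refl
≤-if false _   x≡0 = ≤-reflexive (x≡0 refl)

if-not-≤ : ∀ b {x c} → (b ≡ false → c ≤ x) → (if not b then c else 0) ≤ x
if-not-≤ true  _   = z≤n
if-not-≤ false c≤x = c≤x refl

2≤countTrue+countTrueIfSingle : ∀ {n} (f : Fin n → Bool) → 1 ≤ countTrue f →
  2 ≤ countTrue f + countTrue (λ i → f i ∧ (countTrue f ≡ᵇ 1))
2≤countTrue+countTrueIfSingle f pos with countTrue f in c
... | 1 = s≤s (≤-trans pos (≤-reflexive (trans (sym c) (countTrue-cong (sym ∘ ∧-identityʳ ∘ f)))))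
... | suc (suc _) = s≤s (s≤s z≤n)

module Domination {n : ℕ} (D : Fin n → Fin n → Bool) (S : Fin n → Bool) where

  dominates : Fin n → Fin n → Bool
  dominates v u = S v ∧ not (S u) ∧ D v u

  dominators : Fin n → ℕ
  dominators u = countTrue (λ v → dominates v u)

  solelyDominates : Fin n → Fin n → Bool
  solelyDominates v u = dominates v u ∧ (dominators u ≡ᵇ 1)

  dominates-intro : ∀ {v u} → S v ≡ true → S u ≡ false → D v u ≡ true → dominates v u ≡ true
  dominates-intro sv su dvu rewrite sv | su | dvu = refl

  dominates-elim : ∀ {v u} → dominates v u ≡ true → S v ≡ true × S u ≡ false × D v u ≡ true
  dominates-elim {v} {u} _ with S v | S u | D v u
  ... | true | false | true = refl , refl , refl

  dominates-from-outside : ∀ {v} → S v ≡ false → ∀ u → dominates v u ≡ false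
  dominates-from-outside sv u rewrite sv = refl

  2≤dominators+soleDominators : (∀ u → S u ≡ false → ∃[ v ] (S v ≡ true × D v u ≡ true)) →
    ∀ {u} → S u ≡ false → 2 ≤ dominators u + countTrue (λ v → solelyDominates v u)
  2≤dominators+soleDominators dominating {u} su with dominating u su
  ... | v , sv , dvu = 2≤countTrue+countTrueIfSingle (λ v → dominates v u)
                         (countTrue-pos v (dominates-intro sv su dvu))

  solelyDominates-elim : ∀ {v u} → solelyDominates v u ≡ true →
                         dominates v u ≡ true × dominators u ≡ 1
  solelyDominates-elim {v} {u} sole with dominates v u | dominators u ≡ᵇ 1 in one
  ... | true | true = refl , ≡ᵇ⇒≡ _ 1 (subst T (sym one) _)

  solelyDominates⇒dominates : ∀ {v u} → solelyDominates v u ≡ true → dominates v u ≡ true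
  solelyDominates⇒dominates = proj₁ ∘ solelyDominates-elim

  countTrue-dominates-≤ : (G : Graph n) → (∀ v u → D v u ≡ true → adj G v u ≡ true) →
                          ∀ v → countTrue (dominates v) ≤ (if S v then maxDegree G else 0)
  countTrue-dominates-≤ G arcs⇒edges v = ≤-if (S v)
    (λ _ → ≤-trans (countTrue-mono λ u d → arcs⇒edges v u (proj₂ (proj₂ (dominates-elim d))))
                   (maxOver-upperBound (degree G) v))
    (λ sv → countTrue-allFalse (dominates-from-outside sv))

  solelyDominates-arcs : ∀ {v u w v′} → solelyDominates v u ≡ true → dominates v w ≡ true →
                         S v′ ≡ true → D v′ u ≡ true → D v′ w ≡ true
  solelyDominates-arcs {v} {v′ = v′} sole dvw sv′ dv′u with solelyDominates-elim sole
  ... | dvu , one with dominates-elim dvu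
  ...   | _ , su , _ = subst (λ x → D x _ ≡ true) v≡v′ (proj₂ (proj₂ (dominates-elim dvw)))
    where
    v≡v′ : v ≡ v′
    v≡v′ = countTrue≤1⇒unique (≤-reflexive one) v v′ dvu (dominates-intro sv′ su dv′u)

  solelyDominates-sameArcs : ∀ {v u w v′} → solelyDominates v u ≡ true →
                             solelyDominates v w ≡ true → S v′ ≡ true → D v′ u ≡ D v′ w
  solelyDominates-sameArcs {v} {u} {w} {v′} solu solw sv′ with D v′ u in e₁ | D v′ w in e₂
  ... | true  | true  = refl
  ... | false | false = refl
  ... | true  | false = sym (trans (sym e₂) (solelyDominates-arcs solu (solelyDominates⇒dominates solw) sv′ e₁))
  ... | false | true  = trans (sym e₁) (solelyDominates-arcs solw (solelyDominates⇒dominates solu) sv′ e₂)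

  countTrue-solelyDominates-≤ :
    (∀ u w → S u ≡ false → S w ≡ false → u ≢ w → ∃[ v ] (S v ≡ true × ¬ (D v u ≡ D v w))) →
    ∀ v → countTrue (solelyDominates v) ≤ (if S v then 1 else 0)
  countTrue-solelyDominates-≤ locating v = ≤-if (S v) (λ _ → countTrue≤1 unique)
    (λ sv → countTrue-allFalse λ u → cong (_∧ (dominators u ≡ᵇ 1)) (dominates-from-outside sv u))
    where
    outside : ∀ {u} → solelyDominates v u ≡ true → S u ≡ false
    outside = proj₁ ∘ proj₂ ∘ dominates-elim ∘ solelyDominates⇒dominates
    unique : ∀ u w → solelyDominates v u ≡ true → solelyDominates v w ≡ true → u ≡ w
    unique u w solu solw with u Fin.≟ w
    ... | yes u≡w = u≡w
    ... | no u≢w with locating u w (outside solu) (outside solw) u≢w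
    ...   | v′ , sv′ , differ = contradiction (solelyDominates-sameArcs solu solw sv′) differ

  complement*2≤ : (G : Graph n) → IsOrientation G D → IsLocatingDominating D S →
                  countTrue (not ∘ S) * 2 ≤ size S * maxDegree G + size S * 1
  complement*2≤ G (_ , arcs⇒edges) (dominating , locating) = begin
    countTrue (not ∘ S) * 2
      ≡⟨ ∑-if (not ∘ S) 2 ⟨
    ∑[ u < n ] (if not (S u) then 2 else 0)
      ≤⟨ ∑-mono-≤ (λ u → if-not-≤ (S u) (2≤dominators+soleDominators dominating)) ⟩
    ∑[ u < n ] (dominators u + countTrue (λ v → solelyDominates v u))
      ≡⟨ ∑-distrib-+ dominators (λ u → countTrue (λ v → solelyDominates v u)) ⟩
    ∑[ u < n ] dominators u + ∑[ u < n ] countTrue (λ v → solelyDominates v u)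
      ≡⟨ cong₂ _+_ (∑-countTrue-comm dominates) (∑-countTrue-comm solelyDominates) ⟩
    ∑[ v < n ] countTrue (dominates v) + ∑[ v < n ] countTrue (solelyDominates v)
      ≤⟨ +-mono-≤ (∑-mono-≤ (countTrue-dominates-≤ G arcs⇒edges))
                  (∑-mono-≤ (countTrue-solelyDominates-≤ locating)) ⟩
    ∑[ v < n ] (if S v then maxDegree G else 0) + ∑[ v < n ] (if S v then 1 else 0)
      ≡⟨ cong₂ _+_ (∑-if S (maxDegree G)) (∑-if S 1) ⟩
    size S * maxDegree G + size S * 1
      ∎
    where open ≤-Reasoning

lemma15 : (n : ℕ) (G : Graph n) (D : Fin n → Fin n → Bool) → IsOrientation G D →
          (S : Fin n → Bool) → IsLocatingDominating D S →
          2 * n ≤ size S * (maxDegree G + 3)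
lemma15 n G D orientation S locating = begin
  2 * n                                ≡⟨ cong (2 *_) (countTrue-complement S) ⟨
  2 * (k + m)                          ≡⟨ regroup k m ⟩
  (k + k) + m * 2                      ≤⟨ +-monoʳ-≤ (k + k) (Domination.complement*2≤ D S G orientation locating) ⟩
  (k + k) + (k * Δ + k * 1)            ≡⟨ collect k Δ ⟩
  k * (Δ + 3)                          ∎
  where
  open ≤-Reasoning
  k m Δ : ℕ
  k = size S
  m = countTrue (not ∘ S)
  Δ = maxDegree G
  regroup : ∀ k m → 2 * (k + m) ≡ (k + k) + m * 2
  regroup = solve-∀
  collect : ∀ k Δ → (k + k) + (k * Δ + k * 1) ≡ k * (Δ + 3)
  collect = solve-∀
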